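{- Let $A=\mathbb C[t]$. (a) If $\Psi$ is the invariant of rooted forests defined (as in the context) with $\Xi=\Delta^{ -1}$, then $\Psi(F)=\bar\Omega(F)$ for every rooted forest $F$. (b) If $\Psi$ is the invariant defined with $\Xi=\nabla^{ -1}$, then $\Psi(F)=\Omega(F)$ for every rooted forest $F$.
   Context: A rooted tree is a finite connected acyclic graph with a distinguished vertex (its root); a rooted forest is a finite disjoint union of rooted trees. A rooted forest is regarded as a finite poset where $x<y$ iff $x$ lies on the path from $y$ to the root of its component and $x\neq y$ (so roots are minimal). For a finite poset $P$, the strict order polynomial $\bar\Omega(P)\in\mathbb C[t]$ is the unique polynomial such that for every integer $n\ge1$, $\bar\Omega(P)(n)$ is the number of maps $\phi:P\to\{1,\dots,n\}$ with $x>y\Rightarrow\phi(x)>\phi(y)$; the order polynomial $\Omega(P)$ is the unique polynomial with $\Omega(P)(n)$ the number of maps with $x>y\Rightarrow\phi(x)\ge\phi(y)$. Define $\Delta f(t)=f(t+1)-f(t)$ and $\nabla f(t)=f(t)-f(t-1)$ on $\mathbb C[t]$; for $g\in\mathbb C[t]$, $\Delta^{ -1}(g)$ (resp. $\nabla^{ -1}(g)$) is the unique $f\in t\mathbb C[t]$ with $\Delta f=g$ (resp. $\nabla f=g$). In a rooted tree, a vertex $w$ is a child of $v$ if $v,w$ are adjacent and $w$ is farther from the root; a leaf has no children. For a $\mathbb C$-linear $\Xi:A\to A$, the invariant $\Psi$ is: for a rooted tree $T$, set $N_v=\Xi(1)$ for each leaf $v$ and inductively $N_v=\Xi(N_{v_1}\cdots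 N_{v_k})$ for a vertex $v$ with distinct children $v_1,\dots,v_k$, and $\Psi(T)=N_{\mathrm{rt}_T}$; for a forest with components $T_1,\dots,T_m$, $\Psi=\prod_i\Psi(T_i)$. -}

module Defs where

open import Data.Nat as ℕ using (ℕ; zero; suc)
open import Data.Fin using (Fin; toℕ)
open import Data.Fin.Properties using (all?)
open import Data.List using (List; []; _∷_; length; map; concatMap; filter; allFin; lookup; upTo)
open import Data.Vec as Vec using (Vec)
open import Data.Integer using (+_)
open import Data.Rational using (ℚ; 0ℚ; 1ℚ; _+_; _-_; _*_; _/_)
open import Relation.Nullary using (Dec; yes; no; ¬_)
open import Relation.Binary.PropositionalEquality using (_≡_; refl)
open import Data.Product using (_×_)

data Tree : Set where
  node : List Tree → Tree

Forest : Set
Forest = List Tree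

-- Vertices of a forest, encoded as paths of child indices:
-- [ i ] is the root of the i-th component, p ++ [ j ] is the j-th child
-- of the vertex p.

treeVerts : Tree → List (List ℕ)
forestVerts : ℕ → Forest → List (List ℕ)

treeVerts (node ts) = [] ∷ forestVerts 0 ts

forestVerts k [] = []
forestVerts k (t ∷ ts) =
  Data.List._++_ (map (k ∷_) (treeVerts t)) (forestVerts (suc k) ts)

verts : Forest → List (List ℕ)
verts F = forestVerts 0 F

-- Proper prefix: x ⊏ y iff the vertex x lies on the path from y to the
-- root and x ≠ y, i.e. x < y in the forest poset.
data _⊏_ : List ℕ → List ℕ → Set where
  []⊏∷ : ∀ {y ys} → [] ⊏ (y ∷ ys)
  ∷⊏∷  : ∀ {x xs ys} → xs ⊏ ys → (x ∷ xs) ⊏ (x ∷ ys)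

_⊏?_ : (xs ys : List ℕ) → Dec (xs ⊏ ys)
[] ⊏? [] = no (λ ())
[] ⊏? (y ∷ ys) = yes []⊏∷
(x ∷ xs) ⊏? [] = no (λ ())
(x ∷ xs) ⊏? (y ∷ ys) with x ℕ.≟ y
... | no x≢y = no (λ { (∷⊏∷ _) → x≢y refl })
... | yes refl with xs ⊏? ys
...   | yes p = yes (∷⊏∷ p)
...   | no ¬p = no (λ { (∷⊏∷ p) → ¬p p })

Below : (F : Forest) → Fin (length (verts F)) → Fin (length (verts F)) → Set
Below F x y = lookup (verts F) x ⊏ lookup (verts F) y

-- Maps from the vertex set to {1,…,n}; value of vertex i is toℕ (φ i) + 1.

allVecs : (n k : ℕ) → List (Vec (Fin n) k)
allVecs n zero = Vec.[] ∷ []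
allVecs n (suc k) = concatMap (λ i → map (i Vec.∷_) (allVecs n k)) (allFin n)

Labelling : Forest → ℕ → Set
Labelling F n = Vec (Fin n) (length (verts F))

IsStrict : (F : Forest) (n : ℕ) → Labelling F n → Set
IsStrict F n φ = ∀ x y → Below F y x → toℕ (Vec.lookup φ y) ℕ.< toℕ (Vec.lookup φ x)

IsWeak : (F : Forest) (n : ℕ) → Labelling F n → Set
IsWeak F n φ = ∀ x y → Below F y x → toℕ (Vec.lookup φ y) ℕ.≤ toℕ (Vec.lookup φ x)

impl? : {A B : Set} → Dec A → Dec B → Dec (A → B)
impl? (yes a) (yes b) = yes (λ _ → b)
impl? (yes a) (no ¬b) = no (λ f → ¬b (f a))
impl? (no ¬a) _ = yes (λ a → Data.Empty.⊥-elim (¬a a))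
  where import Data.Empty

isStrict? : (F : Forest) (n : ℕ) (φ : Labelling F n) → Dec (IsStrict F n φ)
isStrict? F n φ = all? (λ x → all? (λ y →
  impl? (lookup (verts F) y ⊏? lookup (verts F) x)
        (toℕ (Vec.lookup φ y) ℕ.<? toℕ (Vec.lookup φ x))))

isWeak? : (F : Forest) (n : ℕ) (φ : Labelling F n) → Dec (IsWeak F n φ)
isWeak? F n φ = all? (λ x → all? (λ y →
  impl? (lookup (verts F) y ⊏? lookup (verts F) x)
        (toℕ (Vec.lookup φ y) ℕ.≤? toℕ (Vec.lookup φ x))))

-- Number of strict / weak order-preserving maps F → {1,…,n}.
-- These are the values Ω̄(F)(n), Ω(F)(n) for n ≥ 1.
strictCount : Forest → ℕ → ℕ
strictCount F n = length (filter (isStrict? F n) (allVecs n (length (verts F))))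

weakCount : Forest → ℕ → ℕ
weakCount F n = length (filter (isWeak? F n) (allVecs n (length (verts F))))

-- Polynomials with rational coefficients (constant term first).

Poly : Set
Poly = List ℚ

oneP : Poly
oneP = 1ℚ ∷ []

_+P_ : Poly → Poly → Poly
[] +P q = q
(a ∷ p) +P [] = a ∷ p
(a ∷ p) +P (b ∷ q) = (a + b) ∷ (p +P q)

scaleP : ℚ → Poly → Poly
scaleP c p = map (c *_) p

_*P_ : Poly → Poly → Poly
[] *P q = []
(a ∷ p) *P q = scaleP a q +P (0ℚ ∷ (p *P q))

eval : Poly → ℚ → ℚ
eval [] x = 0ℚ
eval (a ∷ p) x = a + x * eval p x

ℕtoℚ : ℕ → ℚ
ℕtoℚ n = (+ n) / 1

-- Ξ is Δ⁻¹: Ξ g is the (unique) f ∈ t·ℚ[t] with Δ f = g.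
IsΔInverse : (Poly → Poly) → Set
IsΔInverse Ξ = ∀ g → (eval (Ξ g) 0ℚ ≡ 0ℚ)
                   × (∀ x → eval (Ξ g) (x + 1ℚ) - eval (Ξ g) x ≡ eval g x)

-- Ξ is ∇⁻¹: Ξ g is the (unique) f ∈ t·ℚ[t] with ∇ f = g.
Is∇Inverse : (Poly → Poly) → Set
Is∇Inverse Ξ = ∀ g → (eval (Ξ g) 0ℚ ≡ 0ℚ)
                   × (∀ x → eval (Ξ g) x - eval (Ξ g) (x - 1ℚ) ≡ eval g x)

ΨT : (Poly → Poly) → Tree → Poly
ΨF : (Poly → Poly) → Forest → Poly
ΨT Ξ (node ts) = Ξ (ΨF Ξ ts)
ΨF Ξ [] = oneP
ΨF Ξ (t ∷ ts) = ΨT Ξ t *P ΨF Ξ ts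

-- Both sides are compared at every natural number n. The number of order-preserving
-- maps F → {1,…,n} is multiplicative over the components of F, and for a tree with root
-- label a the rest of the tree is labelled in a translate of {1,…,n−a} (strict case)
-- or of {1,…,n−a+1} (weak case). Summing over a gives, for the tree B⁺F obtained by
-- grafting F onto a new root,
--   Ω̄(B⁺F)(n) = Σ_{j<n} Ω̄(F)(j)   and   Ω(B⁺F)(n) = Σ_{1≤j≤n} Ω(F)(j),
-- which are exactly the recursions satisfied at integers by Δ⁻¹ and ∇⁻¹ applied to a
-- polynomial. Since Ψ is multiplicative by definition, induction on the forest
-- identifies the two.

module Submission where

open import Defs
open import Data.Bool using (Bool; true; false; T; if_then_else_; _∧_)
open import Data.Bool.ListAction using (all)
open import Data.Bool.Properties using (T-∧)
open import Data.Empty using (⊥-elim)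
open import Data.Fin as Fin using (Fin; toℕ)
import Data.Integer as ℤ
import Data.Integer.Properties as ℤ
open import Data.List
  using (List; []; _∷_; [_]; _++_; map; concatMap; filter; filterᵇ; zip; length; take; drop; lookup; tabulate; allFin)
open import Data.List.Membership.Propositional using (_∈_)
open import Data.List.Membership.Propositional.Properties using (∈-map⁺; ∈-map⁻; ∈-++⁺ˡ; ∈-++⁺ʳ; ∈-++⁻)
open import Data.List.Properties
  using (map-cong; map-∘; map-tabulate; tabulate-cong; filter-all; filter-reject; take-map; drop-map; take++drop≡id;
         length-++; length-map; length-take; length-drop)
open import Data.List.Relation.Unary.All as All using (All; []; _∷_)
open import Data.List.Relation.Unary.All.Properties using (all⁺; all⁻)
open import Data.List.Relation.Unary.Any using (here; there)
open import Data.Nat as ℕ using (ℕ; zero; suc; pred; _+_; _*_; _∸_; _≤_; _≤ᵇ_; _≤?_; z≤n)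
open import Data.Nat.ListAction using (sum)
import Data.Nat.Properties as ℕ
open import Data.Product as Product using (_×_; _,_; proj₁; proj₂; ∃-syntax)
open import Data.Product.Function.NonDependent.Propositional using (_×-⇔_)
open import Data.Rational as ℚ using (0ℚ; 1ℚ)
import Data.Rational.Properties as ℚ
open import Data.Rational.Solver using (module +-*-Solver)
import Data.Rational.Unnormalised as ℚᵘ
import Data.Rational.Unnormalised.Properties as ℚᵘ
open import Data.Sum using (_⊎_; inj₁; inj₂)
open import Data.Vec as Vec using (Vec)
open import Data.Vec.Properties using (lookup-map; length-toList)
open import Function using (_∘_; const)
open import Function.Bundles using (_⇔_; mk⇔; Equivalence)
open import Function.Construct.Composition using (_⇔-∘_)
open import Function.Construct.Identity using (⇔-id)
open import Function.Construct.Symmetry using (⇔-sym)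
open import Function.Properties.Equivalence using (⇔-setoid)
open import Level using (0ℓ)
open import Relation.Binary.PropositionalEquality
  using (_≡_; refl; sym; trans; cong; cong₂; subst; subst₂; _≗_; module ≡-Reasoning)
import Relation.Binary.Reasoning.Setoid as SetoidReasoning
open import Relation.Nullary using (¬_; does)
open import Relation.Nullary.Decidable using (T?; does-⇔)
open import Relation.Unary using (Pred; Decidable)

open +-*-Solver
open Equivalence using (to; from)

private variable A B : Set

module ⇔-Reasoning = SetoidReasoning (⇔-setoid 0ℓ)

-- ℕtoℚ k is definitionally fromℚᵘ (mkℚᵘ (+ k) 0), so the computation is done in ℚᵘ.
ℕtoℚ-suc : ∀ n → ℕtoℚ (suc n) ≡ ℕtoℚ n ℚ.+ 1ℚ
ℕtoℚ-suc n = ℚ.toℚᵘ-injective (begin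
  ℚ.toℚᵘ (ℕtoℚ (suc n))
    ≈⟨ ℚ.toℚᵘ-fromℚᵘ (ℚᵘ.mkℚᵘ (ℤ.+ suc n) 0) ⟩
  ℚᵘ.mkℚᵘ (ℤ.+ suc n) 0
    ≈⟨ ℚᵘ.*≡* (cong (ℤ._* ℤ.+ 1) numerator-suc) ⟩
  ℚᵘ.mkℚᵘ (ℤ.+ n) 0 ℚᵘ.+ ℚᵘ.1ℚᵘ
    ≈⟨ ℚᵘ.+-cong (ℚ.toℚᵘ-fromℚᵘ (ℚᵘ.mkℚᵘ (ℤ.+ n) 0)) ℚᵘ.≃-refl ⟨
  ℚ.toℚᵘ (ℕtoℚ n) ℚᵘ.+ ℚ.toℚᵘ 1ℚ
    ≈⟨ ℚ.toℚᵘ-homo-+ (ℕtoℚ n) 1ℚ ⟨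
  ℚ.toℚᵘ (ℕtoℚ n ℚ.+ 1ℚ)
    ∎)
  where
  open ℚᵘ.≃-Reasoning
  numerator-suc : ℤ.+ suc n ≡ ℤ.+ n ℤ.* ℤ.+ 1 ℤ.+ ℤ.+ 1
  numerator-suc = trans (cong ℤ.+_ (ℕ.+-comm 1 n)) (cong (ℤ._+ ℤ.+ 1) (sym (ℤ.*-identityʳ (ℤ.+ n))))

ℕtoℚ-homo-+ : ∀ m n → ℕtoℚ (m + n) ≡ ℕtoℚ m ℚ.+ ℕtoℚ n
ℕtoℚ-homo-+ zero    n = sym (ℚ.+-identityˡ (ℕtoℚ n))
ℕtoℚ-homo-+ (suc m) n = begin
  ℕtoℚ (suc (m + n))
    ≡⟨ ℕtoℚ-suc (m + n) ⟩
  ℕtoℚ (m + n) ℚ.+ 1ℚ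
    ≡⟨ cong (ℚ._+ 1ℚ) (ℕtoℚ-homo-+ m n) ⟩
  ℕtoℚ m ℚ.+ ℕtoℚ n ℚ.+ 1ℚ
    ≡⟨ solve 2 (λ x y → x :+ y :+ con 1ℚ := x :+ con 1ℚ :+ y) refl (ℕtoℚ m) (ℕtoℚ n) ⟩
  ℕtoℚ m ℚ.+ 1ℚ ℚ.+ ℕtoℚ n
    ≡⟨ cong (ℚ._+ ℕtoℚ n) (ℕtoℚ-suc m) ⟨
  ℕtoℚ (suc m) ℚ.+ ℕtoℚ n
    ∎
  where open ≡-Reasoning

ℕtoℚ-homo-* : ∀ m n → ℕtoℚ (m * n) ≡ ℕtoℚ m ℚ.* ℕtoℚ n
ℕtoℚ-homo-* zero    n = sym (ℚ.*-zeroˡ (ℕtoℚ n))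
ℕtoℚ-homo-* (suc m) n = begin
  ℕtoℚ (n + m * n)
    ≡⟨ ℕtoℚ-homo-+ n (m * n) ⟩
  ℕtoℚ n ℚ.+ ℕtoℚ (m * n)
    ≡⟨ cong (ℕtoℚ n ℚ.+_) (ℕtoℚ-homo-* m n) ⟩
  ℕtoℚ n ℚ.+ ℕtoℚ m ℚ.* ℕtoℚ n
    ≡⟨ solve 2 (λ x y → y :+ x :* y := (x :+ con 1ℚ) :* y) refl (ℕtoℚ m) (ℕtoℚ n) ⟩
  (ℕtoℚ m ℚ.+ 1ℚ) ℚ.* ℕtoℚ n
    ≡⟨ cong (ℚ._* ℕtoℚ n) (ℕtoℚ-suc m) ⟨
  ℕtoℚ (suc m) ℚ.* ℕtoℚ n
    ∎
  where open ≡-Reasoning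

eval-oneP : ∀ x → eval oneP x ≡ 1ℚ
eval-oneP x = solve 1 (λ x → con 1ℚ :+ x :* con 0ℚ := con 1ℚ) refl x

eval-+P : ∀ p q x → eval (p +P q) x ≡ eval p x ℚ.+ eval q x
eval-+P []      q       x = sym (ℚ.+-identityˡ (eval q x))
eval-+P (a ∷ p) []      x = sym (ℚ.+-identityʳ (eval (a ∷ p) x))
eval-+P (a ∷ p) (b ∷ q) x = begin
  a ℚ.+ b ℚ.+ x ℚ.* eval (p +P q) x
    ≡⟨ cong (λ v → a ℚ.+ b ℚ.+ x ℚ.* v) (eval-+P p q x) ⟩
  a ℚ.+ b ℚ.+ x ℚ.* (eval p x ℚ.+ eval q x)
    ≡⟨ solve 5 (λ a b x u v → a :+ b :+ x :* (u :+ v) := a :+ x :* u :+ (b :+ x :* v))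
               refl a b x (eval p x) (eval q x) ⟩
  a ℚ.+ x ℚ.* eval p x ℚ.+ (b ℚ.+ x ℚ.* eval q x)
    ∎
  where open ≡-Reasoning

eval-scaleP : ∀ c p x → eval (scaleP c p) x ≡ c ℚ.* eval p x
eval-scaleP c []      x = sym (ℚ.*-zeroʳ c)
eval-scaleP c (a ∷ p) x = begin
  c ℚ.* a ℚ.+ x ℚ.* eval (scaleP c p) x
    ≡⟨ cong (λ v → c ℚ.* a ℚ.+ x ℚ.* v) (eval-scaleP c p x) ⟩
  c ℚ.* a ℚ.+ x ℚ.* (c ℚ.* eval p x)
    ≡⟨ solve 4 (λ c a x u → c :* a :+ x :* (c :* u) := c :* (a :+ x :* u)) refl c a x (eval p x) ⟩
  c ℚ.* (a ℚ.+ x ℚ.* eval p x)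
    ∎
  where open ≡-Reasoning

eval-*P : ∀ p q x → eval (p *P q) x ≡ eval p x ℚ.* eval q x
eval-*P []      q x = sym (ℚ.*-zeroˡ (eval q x))
eval-*P (a ∷ p) q x = begin
  eval (scaleP a q +P (0ℚ ∷ p *P q)) x
    ≡⟨ eval-+P (scaleP a q) (0ℚ ∷ p *P q) x ⟩
  eval (scaleP a q) x ℚ.+ (0ℚ ℚ.+ x ℚ.* eval (p *P q) x)
    ≡⟨ cong₂ (λ u v → u ℚ.+ (0ℚ ℚ.+ x ℚ.* v)) (eval-scaleP a q x) (eval-*P p q x) ⟩
  a ℚ.* eval q x ℚ.+ (0ℚ ℚ.+ x ℚ.* (eval p x ℚ.* eval q x))
    ≡⟨ solve 4 (λ a x u v → a :* v :+ (con 0ℚ :+ x :* (u :* v)) := (a :+ x :* u) :* v)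
               refl a x (eval p x) (eval q x) ⟩
  (a ℚ.+ x ℚ.* eval p x) ℚ.* eval q x
    ∎
  where open ≡-Reasoning

sumTo : (ℕ → ℕ) → ℕ → ℕ
sumTo f zero    = 0
sumTo f (suc n) = sumTo f n + f n

Interpolates : Poly → (ℕ → ℕ) → Set
Interpolates p c = ∀ n → eval p (ℕtoℚ n) ≡ ℕtoℚ (c n)

x-y≡z⇒x≡y+z : ∀ {x y z} → x ℚ.- y ≡ z → x ≡ y ℚ.+ z
x-y≡z⇒x≡y+z {x} {y} refl = solve 2 (λ x y → x := y :+ (x :- y)) refl x y

ΔInverse-sumTo : ∀ Ξ → IsΔInverse Ξ → ∀ g c → Interpolates g c → Interpolates (Ξ g) (sumTo c)
ΔInverse-sumTo Ξ Δ⁻¹ g c g≈c zero    = proj₁ (Δ⁻¹ g)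
ΔInverse-sumTo Ξ Δ⁻¹ g c g≈c (suc n) = begin
  eval (Ξ g) (ℕtoℚ (suc n))
    ≡⟨ cong (eval (Ξ g)) (ℕtoℚ-suc n) ⟩
  eval (Ξ g) (ℕtoℚ n ℚ.+ 1ℚ)
    ≡⟨ x-y≡z⇒x≡y+z (proj₂ (Δ⁻¹ g) (ℕtoℚ n)) ⟩
  eval (Ξ g) (ℕtoℚ n) ℚ.+ eval g (ℕtoℚ n)
    ≡⟨ cong₂ ℚ._+_ (ΔInverse-sumTo Ξ Δ⁻¹ g c g≈c n) (g≈c n) ⟩
  ℕtoℚ (sumTo c n) ℚ.+ ℕtoℚ (c n)
    ≡⟨ ℕtoℚ-homo-+ (sumTo c n) (c n) ⟨
  ℕtoℚ (sumTo c (suc n))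
    ∎
  where open ≡-Reasoning

∇Inverse-sumTo : ∀ Ξ → Is∇Inverse Ξ → ∀ g c → Interpolates g c → Interpolates (Ξ g) (sumTo (c ∘ suc))
∇Inverse-sumTo Ξ ∇⁻¹ g c g≈c zero    = proj₁ (∇⁻¹ g)
∇Inverse-sumTo Ξ ∇⁻¹ g c g≈c (suc n) = begin
  eval (Ξ g) (ℕtoℚ (suc n))
    ≡⟨ x-y≡z⇒x≡y+z (proj₂ (∇⁻¹ g) (ℕtoℚ (suc n))) ⟩
  eval (Ξ g) (ℕtoℚ (suc n) ℚ.- 1ℚ) ℚ.+ eval g (ℕtoℚ (suc n))
    ≡⟨ cong (λ x → eval (Ξ g) x ℚ.+ eval g (ℕtoℚ (suc n))) ℕtoℚ-suc-1 ⟩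
  eval (Ξ g) (ℕtoℚ n) ℚ.+ eval g (ℕtoℚ (suc n))
    ≡⟨ cong₂ ℚ._+_ (∇Inverse-sumTo Ξ ∇⁻¹ g c g≈c n) (g≈c (suc n)) ⟩
  ℕtoℚ (sumTo (c ∘ suc) n) ℚ.+ ℕtoℚ (c (suc n))
    ≡⟨ ℕtoℚ-homo-+ (sumTo (c ∘ suc) n) (c (suc n)) ⟨
  ℕtoℚ (sumTo (c ∘ suc) (suc n))
    ∎
  where
  open ≡-Reasoning
  ℕtoℚ-suc-1 : ℕtoℚ (suc n) ℚ.- 1ℚ ≡ ℕtoℚ n
  ℕtoℚ-suc-1 = trans (cong (ℚ._- 1ℚ) (ℕtoℚ-suc n))
                     (solve 1 (λ x → x :+ con 1ℚ :- con 1ℚ := x) refl (ℕtoℚ n))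

count : (A → Bool) → List A → ℕ
count p []       = 0
count p (x ∷ xs) = if p x then suc (count p xs) else count p xs

count-++ : ∀ (p : A → Bool) xs ys → count p (xs ++ ys) ≡ count p xs + count p ys
count-++ p []       ys = refl
count-++ p (x ∷ xs) ys with p x
... | true  = cong suc (count-++ p xs ys)
... | false = count-++ p xs ys

count-map : ∀ (p : B → Bool) (f : A → B) xs → count p (map f xs) ≡ count (p ∘ f) xs
count-map p f []       = refl
count-map p f (x ∷ xs) with p (f x)
... | true  = cong suc (count-map p f xs)
... | false = count-map p f xs

count-cong : ∀ {p q : A → Bool} → p ≗ q → count p ≗ count q
count-cong p≗q []       = refl
count-cong {q = q} p≗q (x ∷ xs) rewrite p≗q x with q x
... | true  = cong suc (count-cong p≗q xs)
... | false = count-cong p≗q xs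

count-false : ∀ (xs : List A) → count (const false) xs ≡ 0
count-false []       = refl
count-false (x ∷ xs) = count-false xs

count-concatMap : ∀ (p : B → Bool) (f : A → List B) xs →
                  count p (concatMap f xs) ≡ sum (map (count p ∘ f) xs)
count-concatMap p f []       = refl
count-concatMap p f (x ∷ xs) =
  trans (count-++ p (f x) (concatMap f xs)) (cong (count p (f x) +_) (count-concatMap p f xs))

length-filter≡count : ∀ {P : Pred A 0ℓ} (P? : Decidable P) xs → length (filter P? xs) ≡ count (does ∘ P?) xs
length-filter≡count P? []       = refl
length-filter≡count P? (x ∷ xs) with does (P? x)
... | true  = cong suc (length-filter≡count P? xs)
... | false = length-filter≡count P? xs

sum-map-*ʳ : ∀ (f : A → ℕ) c xs → sum (map (λ x → f x * c) xs) ≡ sum (map f xs) * c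
sum-map-*ʳ f c []       = refl
sum-map-*ʳ f c (x ∷ xs) =
  trans (cong (f x * c +_) (sum-map-*ʳ f c xs)) (sym (ℕ.*-distribʳ-+ c (f x) (sum (map f xs))))

sum-map-if : ∀ (p : A → Bool) (f : A → ℕ) xs →
             sum (map (λ x → if p x then f x else 0) xs) ≡ sum (map f (filterᵇ p xs))
sum-map-if p f []       = refl
sum-map-if p f (x ∷ xs) with p x
... | true  = cong (f x +_) (sum-map-if p f xs)
... | false = sum-map-if p f xs

labellings : List A → ℕ → List (List A)
labellings V zero    = [ [] ]
labellings V (suc k) = concatMap (λ a → map (a ∷_) (labellings V k)) V

count-labellings-suc : ∀ (p : List A → Bool) V k →
  count p (labellings V (suc k)) ≡ sum (map (λ a → count (p ∘ (a ∷_)) (labellings V k)) V)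
count-labellings-suc p V k = trans (count-concatMap p _ V)
  (cong sum (map-cong (λ a → count-map p (a ∷_) (labellings V k)) V))

count-labellings-map : ∀ (p : List B → Bool) (f : A → B) V k →
  count p (labellings (map f V) k) ≡ count (p ∘ map f) (labellings V k)
count-labellings-map p f V zero    = refl
count-labellings-map p f V (suc k) = begin
  count p (labellings (map f V) (suc k))
    ≡⟨ count-labellings-suc p (map f V) k ⟩
  sum (map (λ b → count (p ∘ (b ∷_)) (labellings (map f V) k)) (map f V))
    ≡⟨ cong sum (map-∘ V) ⟨
  sum (map (λ a → count (p ∘ (f a ∷_)) (labellings (map f V) k)) V)
    ≡⟨ cong sum (map-cong (λ a → count-labellings-map (p ∘ (f a ∷_)) f V k) V) ⟩
  sum (map (λ a → count (p ∘ map f ∘ (a ∷_)) (labellings V k)) V)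
    ≡⟨ count-labellings-suc (p ∘ map f) V k ⟨
  count (p ∘ map f) (labellings V (suc k))
    ∎
  where open ≡-Reasoning

count-labellings-+ : ∀ (p q : List A → Bool) V k m →
  count (λ l → p (take k l) ∧ q (drop k l)) (labellings V (k + m)) ≡
  count p (labellings V k) * count q (labellings V m)
count-labellings-+ p q V zero m with p []
... | true  = sym (ℕ.+-identityʳ _)
... | false = count-false (labellings V m)
count-labellings-+ p q V (suc k) m = begin
  count (λ l → p (take (suc k) l) ∧ q (drop (suc k) l)) (labellings V (suc k + m))
    ≡⟨ count-labellings-suc _ V (k + m) ⟩
  sum (map (λ a → count (λ l → p (a ∷ take k l) ∧ q (drop k l)) (labellings V (k + m))) V)
    ≡⟨ cong sum (map-cong (λ a → count-labellings-+ (p ∘ (a ∷_)) q V k m) V) ⟩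
  sum (map (λ a → count (p ∘ (a ∷_)) (labellings V k) * count q (labellings V m)) V)
    ≡⟨ sum-map-*ʳ _ _ V ⟩
  sum (map (λ a → count (p ∘ (a ∷_)) (labellings V k)) V) * count q (labellings V m)
    ≡⟨ cong (_* count q (labellings V m)) (count-labellings-suc p V k) ⟨
  count p (labellings V (suc k)) * count q (labellings V m)
    ∎
  where open ≡-Reasoning

count-labellings-all : ∀ (q : A → Bool) (p : List A → Bool) V k →
  count (λ l → all q l ∧ p l) (labellings V k) ≡ count p (labellings (filterᵇ q V) k)
count-labellings-all q p V zero    = refl
count-labellings-all q p V (suc k) = begin
  count (λ l → all q l ∧ p l) (labellings V (suc k))
    ≡⟨ count-labellings-suc _ V k ⟩
  sum (map (λ a → count (λ l → (q a ∧ all q l) ∧ p (a ∷ l)) (labellings V k)) V)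
    ≡⟨ cong sum (map-cong (λ a → root-condition a (q a) refl) V) ⟩
  sum (map (λ a → if q a then count (p ∘ (a ∷_)) (labellings (filterᵇ q V) k) else 0) V)
    ≡⟨ sum-map-if q _ V ⟩
  sum (map (λ a → count (p ∘ (a ∷_)) (labellings (filterᵇ q V) k)) (filterᵇ q V))
    ≡⟨ count-labellings-suc p (filterᵇ q V) k ⟨
  count p (labellings (filterᵇ q V) (suc k))
    ∎
  where
  open ≡-Reasoning
  root-condition : ∀ a b → q a ≡ b →
    count (λ l → (b ∧ all q l) ∧ p (a ∷ l)) (labellings V k) ≡
    (if b then count (p ∘ (a ∷_)) (labellings (filterᵇ q V) k) else 0)
  root-condition a true  _ = count-labellings-all q (p ∘ (a ∷_)) V k
  root-condition a false _ = count-false (labellings V k)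

interval : ℕ → ℕ → List ℕ
interval m zero    = []
interval m (suc k) = m ∷ interval (suc m) k

interval-+ : ∀ m i k → interval (m + i) k ≡ map (m +_) (interval i k)
interval-+ m i zero    = refl
interval-+ m i (suc k) = cong (m + i ∷_)
  (trans (cong (λ j → interval j k) (sym (ℕ.+-suc m i))) (interval-+ m (suc i) k))

interval-≥ : ∀ m k → All (m ≤_) (interval m k)
interval-≥ m zero    = []
interval-≥ m (suc k) = ℕ.≤-refl ∷ All.map ℕ.<⇒≤ (interval-≥ (suc m) k)

tabulate-interval : ∀ m n → tabulate {n = n} (λ i → m + toℕ i) ≡ interval m n
tabulate-interval m zero    = refl
tabulate-interval m (suc n) = cong₂ _∷_ (ℕ.+-identityʳ m)
  (trans (tabulate-cong (λ i → ℕ.+-suc m (toℕ i))) (tabulate-interval (suc m) n))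

map-toℕ-allFin : ∀ n → map toℕ (allFin n) ≡ interval 0 n
map-toℕ-allFin n = trans (map-tabulate (λ i → i) toℕ) (tabulate-interval 0 n)

filter-≤ᵇ-interval : ∀ c m k → m ≤ c → filterᵇ (c ≤ᵇ_) (interval m k) ≡ interval c (m + k ∸ c)
filter-≤ᵇ-interval c m zero    m≤c rewrite ℕ.+-identityʳ m | ℕ.m≤n⇒m∸n≡0 m≤c = refl
filter-≤ᵇ-interval c m (suc k) m≤c with ℕ.m≤n⇒m<n∨m≡n m≤c
... | inj₁ m<c = begin
  filterᵇ (c ≤ᵇ_) (interval m (suc k))
    ≡⟨ filter-reject (T? ∘ (c ≤ᵇ_)) (ℕ.<⇒≱ m<c ∘ ℕ.≤ᵇ⇒≤ c m) ⟩
  filterᵇ (c ≤ᵇ_) (interval (suc m) k)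
    ≡⟨ filter-≤ᵇ-interval c (suc m) k m<c ⟩
  interval c (suc m + k ∸ c)
    ≡⟨ cong (λ j → interval c (j ∸ c)) (ℕ.+-suc m k) ⟨
  interval c (m + suc k ∸ c)
    ∎
  where open ≡-Reasoning
... | inj₂ refl = begin
  filterᵇ (c ≤ᵇ_) (interval c (suc k))
    ≡⟨ filter-all (T? ∘ (c ≤ᵇ_)) (All.map ℕ.≤⇒≤ᵇ (interval-≥ c (suc k))) ⟩
  interval c (suc k)
    ≡⟨ cong (interval c) (ℕ.m+n∸m≡n c (suc k)) ⟨
  interval c (c + suc k ∸ c)
    ∎
  where open ≡-Reasoning

sum-interval-reverse : ∀ (f : ℕ → ℕ) m k →
                       sum (map (λ a → f (m + k ∸ a)) (interval m k)) ≡ sumTo (f ∘ suc) k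
sum-interval-reverse f m zero    = refl
sum-interval-reverse f m (suc k) = begin
  f (m + suc k ∸ m) + sum (map (λ a → f (m + suc k ∸ a)) (interval (suc m) k))
    ≡⟨ cong₂ _+_ (cong f (ℕ.m+n∸m≡n m (suc k)))
                 (cong sum (map-cong (λ a → cong (λ j → f (j ∸ a)) (ℕ.+-suc m k)) (interval (suc m) k))) ⟩
  f (suc k) + sum (map (λ a → f (suc m + k ∸ a)) (interval (suc m) k))
    ≡⟨ cong (f (suc k) +_) (sum-interval-reverse f (suc m) k) ⟩
  f (suc k) + sumTo (f ∘ suc) k
    ≡⟨ ℕ.+-comm (f (suc k)) _ ⟩
  sumTo (f ∘ suc) (suc k)
    ∎
  where open ≡-Reasoning

sizeT : Tree → ℕ
sizeF : Forest → ℕ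
sizeT (node ts) = suc (sizeF ts)
sizeF []        = 0
sizeF (t ∷ ts)  = sizeT t + sizeF ts

zip-++ : ∀ (xs ys : List A) (l₁ l₂ : List B) → length xs ≡ length l₁ →
         zip (xs ++ ys) (l₁ ++ l₂) ≡ zip xs l₁ ++ zip ys l₂
zip-++ []       ys []       l₂ _  = refl
zip-++ (x ∷ xs) ys (y ∷ l₁) l₂ eq = cong ((x , y) ∷_) (zip-++ xs ys l₁ l₂ (ℕ.suc-injective eq))

zip-map₁ : ∀ (f : A → A) xs (l : List B) → zip (map f xs) l ≡ map (Product.map₁ f) (zip xs l)
zip-map₁ f []       l       = refl
zip-map₁ f (x ∷ xs) []      = refl
zip-map₁ f (x ∷ xs) (y ∷ l) = cong ((f x , y) ∷_) (zip-map₁ f xs l)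

∈-zip⁻ˡ : ∀ {x y} (xs : List A) (ys : List B) → (x , y) ∈ zip xs ys → x ∈ xs
∈-zip⁻ˡ (_ ∷ xs) (_ ∷ ys) (here refl) = here refl
∈-zip⁻ˡ (_ ∷ xs) (_ ∷ ys) (there m)   = there (∈-zip⁻ˡ xs ys m)

∈-zip-lookup : ∀ (xs : List A) (ys : Vec B (length xs)) i →
               (lookup xs i , Vec.lookup ys i) ∈ zip xs (Vec.toList ys)
∈-zip-lookup (x ∷ xs) (y Vec.∷ ys) Fin.zero    = here refl
∈-zip-lookup (x ∷ xs) (y Vec.∷ ys) (Fin.suc i) = there (∈-zip-lookup xs ys i)

∈-zip-toList⁻ : ∀ {x y} (xs : List A) (ys : Vec B (length xs)) → (x , y) ∈ zip xs (Vec.toList ys) →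
                ∃[ i ] x ≡ lookup xs i × y ≡ Vec.lookup ys i
∈-zip-toList⁻ (_ ∷ xs) (_ Vec.∷ ys) (here refl) = Fin.zero , refl , refl
∈-zip-toList⁻ (_ ∷ xs) (_ Vec.∷ ys) (there m)   = let i , eqs = ∈-zip-toList⁻ xs ys m in Fin.suc i , eqs

length-treeVerts : ∀ t → length (treeVerts t) ≡ sizeT t
length-forestVerts : ∀ k F → length (forestVerts k F) ≡ sizeF F
length-treeVerts (node ts) = cong suc (length-forestVerts 0 ts)
length-forestVerts k []       = refl
length-forestVerts k (t ∷ ts) = trans (length-++ (map (k ∷_) (treeVerts t)))
  (cong₂ _+_ (trans (length-map (k ∷_) (treeVerts t)) (length-treeVerts t)) (length-forestVerts (suc k) ts))

∈-forestVerts⁻ : ∀ {p} k F → p ∈ forestVerts k F → ∃[ h ] ∃[ p′ ] p ≡ h ∷ p′ × k ≤ h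
∈-forestVerts⁻ k (t ∷ ts) m with ∈-++⁻ (map (k ∷_) (treeVerts t)) m
... | inj₁ m₁ = let p′ , _ , eq = ∈-map⁻ (k ∷_) m₁ in k , p′ , eq , ℕ.≤-refl
... | inj₂ m₂ = let h , p′ , eq , k<h = ∈-forestVerts⁻ (suc k) ts m₂ in h , p′ , eq , ℕ.<⇒≤ k<h

[]⊏-forestVerts : ∀ {p} k F → p ∈ forestVerts k F → [] ⊏ p
[]⊏-forestVerts k F m with ∈-forestVerts⁻ k F m
... | _ , _ , refl , _ = []⊏∷

⊏-head : ∀ {h h′ p q} → (h ∷ p) ⊏ (h′ ∷ q) → h ≡ h′
⊏-head (∷⊏∷ _) = refl

Incomparable : List ℕ → List ℕ → Set
Incomparable p q = ¬ p ⊏ q × ¬ q ⊏ p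

All-zip⇔ : ∀ {P : B → Set} (xs : List A) l → length xs ≡ length l →
           All (P ∘ proj₂) (zip xs l) ⇔ All P l
All-zip⇔ []       []      _  = mk⇔ (λ _ → []) (λ _ → [])
All-zip⇔ (x ∷ xs) (y ∷ l) eq =
  mk⇔ (λ { (py ∷ pl) → py ∷ to rest pl }) (λ { (py ∷ pl) → py ∷ from rest pl })
  where rest = All-zip⇔ xs l (ℕ.suc-injective eq)

All-≤⇔T-all : ∀ c l → All (c ≤_) l ⇔ T (all (c ≤ᵇ_) l)
All-≤⇔T-all c l = mk⇔ (all⁻ (c ≤ᵇ_) ∘ All.map ℕ.≤⇒≤ᵇ)
                      (All.map (ℕ.≤ᵇ⇒≤ c _) ∘ all⁺ (c ≤ᵇ_) l)

labelsOf : ∀ {n k} → Vec (Fin n) k → List ℕ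
labelsOf φ = Vec.toList (Vec.map toℕ φ)

count-allVecs : ∀ (p : List ℕ → Bool) n k →
                count (p ∘ labelsOf) (allVecs n k) ≡ count p (labellings (interval 0 n) k)
count-allVecs p n zero    = refl
count-allVecs p n (suc k) = begin
  count (p ∘ labelsOf) (concatMap (λ i → map (i Vec.∷_) (allVecs n k)) (allFin n))
    ≡⟨ count-concatMap (p ∘ labelsOf) _ (allFin n) ⟩
  sum (map (λ i → count (p ∘ labelsOf) (map (i Vec.∷_) (allVecs n k))) (allFin n))
    ≡⟨ cong sum (map-cong (λ i → trans (count-map _ (i Vec.∷_) (allVecs n k))
                                       (count-allVecs (p ∘ (toℕ i ∷_)) n k)) (allFin n)) ⟩
  sum (map (λ i → count (p ∘ (toℕ i ∷_)) (labellings (interval 0 n) k)) (allFin n))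
    ≡⟨ cong sum (map-∘ (allFin n)) ⟩
  sum (map (λ a → count (p ∘ (a ∷_)) (labellings (interval 0 n) k)) (map toℕ (allFin n)))
    ≡⟨ cong (sum ∘ map (λ a → count (p ∘ (a ∷_)) (labellings (interval 0 n) k))) (map-toℕ-allFin n) ⟩
  sum (map (λ a → count (p ∘ (a ∷_)) (labellings (interval 0 n) k)) (interval 0 n))
    ≡⟨ count-labellings-suc p (interval 0 n) k ⟨
  count p (labellings (interval 0 n) (suc k))
    ∎
  where open ≡-Reasoning

-- A label list gives the (0-based) labels of the vertices in the order of treeVerts and
-- forestVerts, so the labels of a subtree form a contiguous block. The parameter d is the
-- least increase of the label from a vertex to its descendants: d = 1 for strict maps,
-- d = 0 for weak ones.
module Gap (d : ℕ) where

  admissibleT : Tree → List ℕ → Bool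
  admissibleF : Forest → List ℕ → Bool
  admissibleT (node ts) []      = false
  admissibleT (node ts) (a ∷ l) = all (d + a ≤ᵇ_) l ∧ admissibleF ts l
  admissibleF []       l = true
  admissibleF (t ∷ ts) l = admissibleT t (take (sizeT t) l) ∧ admissibleF ts (drop (sizeT t) l)

  countT : Tree → ℕ → ℕ
  countT t n = count (admissibleT t) (labellings (interval 0 n) (sizeT t))

  countF : Forest → ℕ → ℕ
  countF F n = count (admissibleF F) (labellings (interval 0 n) (sizeF F))

  countF-∷ : ∀ t ts n → countF (t ∷ ts) n ≡ countT t n * countF ts n
  countF-∷ t ts n = count-labellings-+ (admissibleT t) (admissibleF ts) (interval 0 n) (sizeT t) (sizeF ts)

  ≤ᵇ-translate : ∀ m a b → (d + (m + a) ≤ᵇ m + b) ≡ (d + a ≤ᵇ b)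
  ≤ᵇ-translate m a b = does-⇔ shifted (d + (m + a) ≤? m + b) (d + a ≤? b)
    where
    d+[m+a]≡m+[d+a] : d + (m + a) ≡ m + (d + a)
    d+[m+a]≡m+[d+a] = trans (sym (ℕ.+-assoc d m a)) (trans (cong (_+ a) (ℕ.+-comm d m)) (ℕ.+-assoc m d a))
    shifted : (d + (m + a) ≤ m + b) ⇔ (d + a ≤ b)
    shifted = mk⇔ (ℕ.+-cancelˡ-≤ m (d + a) b ∘ subst (_≤ m + b) d+[m+a]≡m+[d+a])
                  (subst (_≤ m + b) (sym d+[m+a]≡m+[d+a]) ∘ ℕ.+-monoʳ-≤ m)

  admissibleT-translate : ∀ m t l → admissibleT t (map (m +_) l) ≡ admissibleT t l
  admissibleF-translate : ∀ m F l → admissibleF F (map (m +_) l) ≡ admissibleF F l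
  admissibleT-translate m (node ts) []      = refl
  admissibleT-translate m (node ts) (a ∷ l) = cong₂ _∧_ (all-translate l) (admissibleF-translate m ts l)
    where
    all-translate : ∀ l → all (d + (m + a) ≤ᵇ_) (map (m +_) l) ≡ all (d + a ≤ᵇ_) l
    all-translate []      = refl
    all-translate (b ∷ l) = cong₂ _∧_ (≤ᵇ-translate m a b) (all-translate l)
  admissibleF-translate m []       l = refl
  admissibleF-translate m (t ∷ ts) l = cong₂ _∧_
    (trans (cong (admissibleT t) (take-map (sizeT t) l)) (admissibleT-translate m t (take (sizeT t) l)))
    (trans (cong (admissibleF ts) (drop-map (sizeT t) l)) (admissibleF-translate m ts (drop (sizeT t) l)))

  countF-interval : ∀ F c n → count (admissibleF F) (labellings (interval c n) (sizeF F)) ≡ countF F n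
  countF-interval F c n = begin
    count (admissibleF F) (labellings (interval c n) (sizeF F))
      ≡⟨ cong (λ V → count (admissibleF F) (labellings V (sizeF F))) interval-c ⟩
    count (admissibleF F) (labellings (map (c +_) (interval 0 n)) (sizeF F))
      ≡⟨ count-labellings-map (admissibleF F) (c +_) (interval 0 n) (sizeF F) ⟩
    count (admissibleF F ∘ map (c +_)) (labellings (interval 0 n) (sizeF F))
      ≡⟨ count-cong (admissibleF-translate c F) (labellings (interval 0 n) (sizeF F)) ⟩
    countF F n
      ∎
    where
    open ≡-Reasoning
    interval-c : interval c n ≡ map (c +_) (interval 0 n)
    interval-c = trans (cong (λ j → interval j n) (sym (ℕ.+-identityʳ c))) (interval-+ c 0 n)

  countT-node : ∀ ts n → countT (node ts) n ≡ sum (map (λ a → countF ts (n ∸ (d + a))) (interval 0 n))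
  countT-node ts n = trans (count-labellings-suc (admissibleT (node ts)) (interval 0 n) (sizeF ts))
    (cong sum (map-cong root-labelled (interval 0 n)))
    where
    root-labelled : ∀ a → count (admissibleT (node ts) ∘ (a ∷_)) (labellings (interval 0 n) (sizeF ts)) ≡
                          countF ts (n ∸ (d + a))
    root-labelled a = begin
      count (λ l → all (d + a ≤ᵇ_) l ∧ admissibleF ts l) (labellings (interval 0 n) (sizeF ts))
        ≡⟨ count-labellings-all (d + a ≤ᵇ_) (admissibleF ts) (interval 0 n) (sizeF ts) ⟩
      count (admissibleF ts) (labellings (filterᵇ (d + a ≤ᵇ_) (interval 0 n)) (sizeF ts))
        ≡⟨ cong (λ V → count (admissibleF ts) (labellings V (sizeF ts)))
                (filter-≤ᵇ-interval (d + a) 0 n z≤n) ⟩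
      count (admissibleF ts) (labellings (interval (d + a) (n ∸ (d + a))) (sizeF ts))
        ≡⟨ countF-interval ts (d + a) (n ∸ (d + a)) ⟩
      countF ts (n ∸ (d + a))
        ∎
      where open ≡-Reasoning

  Admissible : List (List ℕ × ℕ) → Set
  Admissible Z = ∀ {p a q b} → (p , a) ∈ Z → (q , b) ∈ Z → q ⊏ p → d + b ≤ a

  Admissible-++ : ∀ Z₁ Z₂ → (∀ {p a q b} → (p , a) ∈ Z₁ → (q , b) ∈ Z₂ → Incomparable p q) →
                  Admissible (Z₁ ++ Z₂) ⇔ (Admissible Z₁ × Admissible Z₂)
  Admissible-++ Z₁ Z₂ incomparable = mk⇔ split join
    where
    split : Admissible (Z₁ ++ Z₂) → Admissible Z₁ × Admissible Z₂
    split adm = (λ m₁ m₂ → adm (∈-++⁺ˡ m₁) (∈-++⁺ˡ m₂))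
              , (λ m₁ m₂ → adm (∈-++⁺ʳ Z₁ m₁) (∈-++⁺ʳ Z₁ m₂))
    joined : ∀ {p a q b} → Admissible Z₁ → Admissible Z₂ →
             (p , a) ∈ Z₁ ⊎ (p , a) ∈ Z₂ → (q , b) ∈ Z₁ ⊎ (q , b) ∈ Z₂ → q ⊏ p → d + b ≤ a
    joined adm₁ adm₂ (inj₁ m₁) (inj₁ m₂) = adm₁ m₁ m₂
    joined adm₁ adm₂ (inj₂ m₁) (inj₂ m₂) = adm₂ m₁ m₂
    joined adm₁ adm₂ (inj₁ m₁) (inj₂ m₂) = ⊥-elim ∘ proj₂ (incomparable m₁ m₂)
    joined adm₁ adm₂ (inj₂ m₁) (inj₁ m₂) = ⊥-elim ∘ proj₁ (incomparable m₂ m₁)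
    join : Admissible Z₁ × Admissible Z₂ → Admissible (Z₁ ++ Z₂)
    join (adm₁ , adm₂) m₁ m₂ = joined adm₁ adm₂ (∈-++⁻ Z₁ m₁) (∈-++⁻ Z₁ m₂)

  Admissible-prefix : ∀ k Z → Admissible (map (Product.map₁ (k ∷_)) Z) ⇔ Admissible Z
  Admissible-prefix k Z = mk⇔ shrink extend
    where
    shrink : Admissible (map (Product.map₁ (k ∷_)) Z) → Admissible Z
    shrink adm m₁ m₂ q⊏p = adm (∈-map⁺ _ m₁) (∈-map⁺ _ m₂) (∷⊏∷ q⊏p)
    extend : Admissible Z → Admissible (map (Product.map₁ (k ∷_)) Z)
    extend adm m₁ m₂ q⊏p with ∈-map⁻ _ m₁ | ∈-map⁻ _ m₂ | q⊏p
    ... | _ , m₁′ , refl | _ , m₂′ , refl | ∷⊏∷ q′⊏p′ = adm m₁′ m₂′ q′⊏p′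

  Admissible-root : ∀ a Z → All (([] ⊏_) ∘ proj₁) Z →
                    Admissible (([] , a) ∷ Z) ⇔ (All ((d + a ≤_) ∘ proj₂) Z × Admissible Z)
  Admissible-root a Z above = mk⇔ split join
    where
    split : Admissible (([] , a) ∷ Z) → All ((d + a ≤_) ∘ proj₂) Z × Admissible Z
    split adm = All.tabulate (λ m → adm (there m) (here refl) (All.lookup above m))
              , (λ m₁ m₂ → adm (there m₁) (there m₂))
    join : All ((d + a ≤_) ∘ proj₂) Z × Admissible Z → Admissible (([] , a) ∷ Z)
    join (a≤ , adm) (here refl) _           ()
    join (a≤ , adm) (there m₁)  (here refl) _  = All.lookup a≤ m₁
    join (a≤ , adm) (there m₁)  (there m₂)  lt = adm m₁ m₂ lt

  admissible-treeVerts : ∀ t l → length l ≡ sizeT t →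
                         Admissible (zip (treeVerts t) l) ⇔ T (admissibleT t l)
  admissible-forestVerts : ∀ k F l → length l ≡ sizeF F →
                           Admissible (zip (forestVerts k F) l) ⇔ T (admissibleF F l)
  admissible-treeVerts (node ts) (a ∷ l) eq = begin
    Admissible (([] , a) ∷ Z)
      ≈⟨ Admissible-root a Z above-root ⟩
    (All ((d + a ≤_) ∘ proj₂) Z × Admissible Z)
      ≈⟨ All-zip⇔ (forestVerts 0 ts) l lengths ×-⇔ admissible-forestVerts 0 ts l eq′ ⟩
    (All (d + a ≤_) l × T (admissibleF ts l))
      ≈⟨ All-≤⇔T-all (d + a) l ×-⇔ ⇔-id _ ⟩
    (T (all (d + a ≤ᵇ_) l) × T (admissibleF ts l))
      ≈⟨ T-∧ ⟨
    T (all (d + a ≤ᵇ_) l ∧ admissibleF ts l)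
      ∎
    where
    open ⇔-Reasoning
    Z = zip (forestVerts 0 ts) l
    eq′ : length l ≡ sizeF ts
    eq′ = ℕ.suc-injective eq
    lengths : length (forestVerts 0 ts) ≡ length l
    lengths = trans (length-forestVerts 0 ts) (sym eq′)
    above-root : All (([] ⊏_) ∘ proj₁) Z
    above-root = All.tabulate ([]⊏-forestVerts 0 ts ∘ ∈-zip⁻ˡ _ l)
  admissible-forestVerts k []       l eq = mk⇔ _ (λ _ ())
  admissible-forestVerts k (t ∷ ts) l eq = begin
    Admissible (zip (forestVerts k (t ∷ ts)) l)
      ≡⟨ cong (Admissible ∘ zip (forestVerts k (t ∷ ts))) (take++drop≡id s l) ⟨
    Admissible (zip (map (k ∷_) (treeVerts t) ++ forestVerts (suc k) ts) (l₁ ++ l₂))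
      ≡⟨ cong Admissible (zip-++ (map (k ∷_) (treeVerts t)) _ l₁ l₂ lengths) ⟩
    Admissible (zip (map (k ∷_) (treeVerts t)) l₁ ++ zip (forestVerts (suc k) ts) l₂)
      ≈⟨ Admissible-++ _ _ incomparable ⟩
    (Admissible (zip (map (k ∷_) (treeVerts t)) l₁) × Admissible (zip (forestVerts (suc k) ts) l₂))
      ≡⟨ cong (λ Z → (Admissible Z × Admissible (zip (forestVerts (suc k) ts) l₂)))
              (zip-map₁ (k ∷_) (treeVerts t) l₁) ⟩
    (Admissible (map (Product.map₁ (k ∷_)) (zip (treeVerts t) l₁)) × Admissible (zip (forestVerts (suc k) ts) l₂))
      ≈⟨ Admissible-prefix k _ ×-⇔ ⇔-id _ ⟩
    (Admissible (zip (treeVerts t) l₁) × Admissible (zip (forestVerts (suc k) ts) l₂))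
      ≈⟨ admissible-treeVerts t l₁ length-l₁ ×-⇔ admissible-forestVerts (suc k) ts l₂ length-l₂ ⟩
    (T (admissibleT t l₁) × T (admissibleF ts l₂))
      ≈⟨ T-∧ ⟨
    T (admissibleT t l₁ ∧ admissibleF ts l₂)
      ∎
    where
    open ⇔-Reasoning
    s = sizeT t
    l₁ = take s l
    l₂ = drop s l
    length-l₁ : length l₁ ≡ s
    length-l₁ = trans (length-take s l) (ℕ.m≤n⇒m⊓n≡m (subst (s ≤_) (sym eq) (ℕ.m≤m+n s (sizeF ts))))
    length-l₂ : length l₂ ≡ sizeF ts
    length-l₂ = trans (length-drop s l) (trans (cong (ℕ._∸ s) eq) (ℕ.m+n∸m≡n s (sizeF ts)))
    lengths : length (map (k ∷_) (treeVerts t)) ≡ length l₁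
    lengths = trans (length-map (k ∷_) (treeVerts t)) (trans (length-treeVerts t) (sym length-l₁))
    incomparable : ∀ {p a q b} → (p , a) ∈ zip (map (k ∷_) (treeVerts t)) l₁ →
                   (q , b) ∈ zip (forestVerts (suc k) ts) l₂ → Incomparable p q
    incomparable m₁ m₂
      with ∈-map⁻ (k ∷_) (∈-zip⁻ˡ _ l₁ m₁) | ∈-forestVerts⁻ (suc k) ts (∈-zip⁻ˡ _ l₂ m₂)
    ... | _ , _ , refl | _ , _ , refl , k<h = (λ p⊏q → ℕ.<-irrefl (⊏-head p⊏q) k<h)
                                             , (λ q⊏p → ℕ.<-irrefl (sym (⊏-head q⊏p)) k<h)

  AdmissibleLabelling : ∀ {n} (L : List (List ℕ)) → Vec (Fin n) (length L) → Set
  AdmissibleLabelling L φ =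
    ∀ x y → lookup L y ⊏ lookup L x → d + toℕ (Vec.lookup φ y) ≤ toℕ (Vec.lookup φ x)

  Admissible-zip⇔AdmissibleLabelling : ∀ {n} L (φ : Vec (Fin n) (length L)) →
                                       Admissible (zip L (labelsOf φ)) ⇔ AdmissibleLabelling L φ
  Admissible-zip⇔AdmissibleLabelling L φ = mk⇔ toIndices fromIndices
    where
    ys = Vec.map toℕ φ
    lookup-ys : ∀ x → Vec.lookup ys x ≡ toℕ (Vec.lookup φ x)
    lookup-ys x = lookup-map x toℕ φ
    toIndices : Admissible (zip L (labelsOf φ)) → AdmissibleLabelling L φ
    toIndices adm x y lt = subst₂ (λ u v → d + u ≤ v) (lookup-ys y) (lookup-ys x)
      (adm (∈-zip-lookup L ys x) (∈-zip-lookup L ys y) lt)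
    fromIndices : AdmissibleLabelling L φ → Admissible (zip L (labelsOf φ))
    fromIndices adm m₁ m₂ lt with ∈-zip-toList⁻ L ys m₁ | ∈-zip-toList⁻ L ys m₂
    ... | x , refl , refl | y , refl , refl =
      subst₂ (λ u v → d + u ≤ v) (sym (lookup-ys y)) (sym (lookup-ys x)) (adm x y lt)

  AdmissibleLabelling⇔admissibleF : ∀ F n (φ : Labelling F n) →
                                    AdmissibleLabelling (verts F) φ ⇔ T (admissibleF F (labelsOf φ))
  AdmissibleLabelling⇔admissibleF F n φ =
    admissible-forestVerts 0 F (labelsOf φ) length-labels
      ⇔-∘ ⇔-sym (Admissible-zip⇔AdmissibleLabelling (verts F) φ)
    where
    length-labels : length (labelsOf φ) ≡ sizeF F
    length-labels = trans (length-toList (Vec.map toℕ φ)) (length-forestVerts 0 F)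

  length-filter-admissible : ∀ F n (P? : Decidable (AdmissibleLabelling {n} (verts F))) →
                             length (filter P? (allVecs n (length (verts F)))) ≡ countF F n
  length-filter-admissible F n P? = begin
    length (filter P? (allVecs n (length (verts F))))
      ≡⟨ length-filter≡count P? (allVecs n (length (verts F))) ⟩
    count (does ∘ P?) (allVecs n (length (verts F)))
      ≡⟨ count-cong (λ φ → does-⇔ (AdmissibleLabelling⇔admissibleF F n φ) (P? φ) (T? _))
                    (allVecs n (length (verts F))) ⟩
    count (admissibleF F ∘ labelsOf) (allVecs n (length (verts F)))
      ≡⟨ count-allVecs (admissibleF F) n (length (verts F)) ⟩
    count (admissibleF F) (labellings (interval 0 n) (length (verts F)))
      ≡⟨ cong (count (admissibleF F) ∘ labellings (interval 0 n)) (length-forestVerts 0 F) ⟩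
    countF F n
      ∎
    where open ≡-Reasoning

open Gap

countT-node-strict : ∀ ts n → countT 1 (node ts) n ≡ sumTo (countF 1 ts) n
countT-node-strict ts n = begin
  countT 1 (node ts) n
    ≡⟨ countT-node 1 ts n ⟩
  sum (map (λ a → countF 1 ts (n ∸ suc a)) (interval 0 n))
    ≡⟨ cong sum (map-cong (λ a → cong (countF 1 ts) (ℕ.pred[m∸n]≡m∸[1+n] n a)) (interval 0 n)) ⟨
  sum (map (λ a → countF 1 ts (pred (n ∸ a))) (interval 0 n))
    ≡⟨ sum-interval-reverse (countF 1 ts ∘ pred) 0 n ⟩
  sumTo (countF 1 ts) n
    ∎
  where open ≡-Reasoning

countT-node-weak : ∀ ts n → countT 0 (node ts) n ≡ sumTo (countF 0 ts ∘ suc) n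
countT-node-weak ts n = trans (countT-node 0 ts n) (sum-interval-reverse (countF 0 ts) 0 n)

module _ (d : ℕ) (Ξ : Poly → Poly) (S : (ℕ → ℕ) → ℕ → ℕ)
         (Ξ-interpolates : ∀ g c → Interpolates g c → Interpolates (Ξ g) (S c))
         (countT-node≡ : ∀ ts n → countT d (node ts) n ≡ S (countF d ts) n) where

  ΨT-interpolates : ∀ t → Interpolates (ΨT Ξ t) (countT d t)
  ΨF-interpolates : ∀ F → Interpolates (ΨF Ξ F) (countF d F)
  ΨT-interpolates (node ts) n =
    trans (Ξ-interpolates (ΨF Ξ ts) (countF d ts) (ΨF-interpolates ts) n)
          (cong ℕtoℚ (sym (countT-node≡ ts n)))
  ΨF-interpolates []       n = eval-oneP (ℕtoℚ n)
  ΨF-interpolates (t ∷ ts) n = begin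
    eval (ΨT Ξ t *P ΨF Ξ ts) (ℕtoℚ n)
      ≡⟨ eval-*P (ΨT Ξ t) (ΨF Ξ ts) (ℕtoℚ n) ⟩
    eval (ΨT Ξ t) (ℕtoℚ n) ℚ.* eval (ΨF Ξ ts) (ℕtoℚ n)
      ≡⟨ cong₂ ℚ._*_ (ΨT-interpolates t n) (ΨF-interpolates ts n) ⟩
    ℕtoℚ (countT d t n) ℚ.* ℕtoℚ (countF d ts n)
      ≡⟨ ℕtoℚ-homo-* (countT d t n) (countF d ts n) ⟨
    ℕtoℚ (countT d t n * countF d ts n)
      ≡⟨ cong ℕtoℚ (countF-∷ d t ts n) ⟨
    ℕtoℚ (countF d (t ∷ ts) n)
      ∎
    where open ≡-Reasoning

-- The hypothesis 1 ≤ n is unused: the identity also holds at n = 0.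
proposition6p1 : ((Ξ : Poly → Poly) → IsΔInverse Ξ →
                    ∀ (F : Forest) (n : ℕ) → 1 ≤ n →
                      eval (ΨF Ξ F) (ℕtoℚ n) ≡ ℕtoℚ (strictCount F n))
               × ((Ξ : Poly → Poly) → Is∇Inverse Ξ →
                    ∀ (F : Forest) (n : ℕ) → 1 ≤ n →
                      eval (ΨF Ξ F) (ℕtoℚ n) ≡ ℕtoℚ (weakCount F n))
proposition6p1 =
  (λ Ξ Δ⁻¹ F n _ → trans (ΨF-interpolates 1 Ξ sumTo (ΔInverse-sumTo Ξ Δ⁻¹) countT-node-strict F n)
                         (cong ℕtoℚ (sym (length-filter-admissible 1 F n (isStrict? F n))))) ,
  (λ Ξ ∇⁻¹ F n _ → trans (ΨF-interpolates 0 Ξ (λ c → sumTo (c ∘ suc)) (∇Inverse-sumTo Ξ ∇⁻¹)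
                                           countT-node-weak F n)
                         (cong ℕtoℚ (sym (length-filter-admissible 0 F n (isWeak? F n)))))
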